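{- Let $r\geq 2$, $n\geq 2r+1$ and $k\geq 2$ be such that $\gamma_{\times k}(K(n,r))$ is defined. Then $\gamma_{\times k}(K(n,r))\geq k+r$. Moreover, if $n<r(k+r)$, then $\gamma_{\times k}(K(n,r))\geq k+r+1$.
   Context: The Kneser graph $K(n,r)$ has as vertices the $r$-subsets of $[n]=\{1,\dots,n\}$, two vertices adjacent iff disjoint. For a vertex $v$, $N[v]$ is its closed neighbourhood. A set $D$ of vertices is a $k$-tuple dominating set if $|N[v]\cap D|\geq k$ for every vertex $v$; $\gamma_{\times k}(K(n,r))$ is the minimum cardinality of such a set (defined when $k\leq \binom{n-r}{r}+1$). -}

module Defs where

open import Data.Nat using (ℕ; _≥_; _+_)
open import Data.Fin.Subset using (Subset; ∣_∣; _∩_; ⊥)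
open import Data.Product using (Σ; _×_; proj₁)
open import Data.Sum using (_⊎_)
open import Data.List using (List; length; filter; map)
open import Data.List.Relation.Unary.Unique.Propositional using (Unique)
open import Data.List.Relation.Unary.All using (All)
open import Relation.Binary.PropositionalEquality using (_≡_)
open import Relation.Nullary using (Dec; yes; no)
open import Data.Vec.Properties using (≡-dec)
import Data.Bool as B

_≟_ : {n : ℕ} (u v : Subset n) → Dec (u ≡ v)
_≟_ = ≡-dec B._≟_
open import Data.Sum using (inj₁; inj₂)

-- Vertices of the Kneser graph K(n,r): r-subsets of [n] (as Subset n = Vec Bool n).
KVertex : ℕ → ℕ → Set
KVertex n r = Σ (Subset n) (λ s → ∣ s ∣ ≡ r)

InClosedNbhd : {n : ℕ} → Subset n → Subset n → Set
InClosedNbhd u v = (u ≡ v) ⊎ (u ∩ v ≡ ⊥)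

inClosedNbhd? : {n : ℕ} (u v : Subset n) → Dec (InClosedNbhd u v)
inClosedNbhd? u v with u ≟ v
... | yes p = yes (inj₁ p)
... | no ¬p with (u ∩ v) ≟ ⊥
...   | yes q = yes (inj₂ q)
...   | no ¬q = no λ { (inj₁ p) → ¬p p ; (inj₂ q) → ¬q q }

closedNbhdCount : {n r : ℕ} → List (KVertex n r) → KVertex n r → ℕ
closedNbhdCount D v = length (filter (λ d → inClosedNbhd? (proj₁ d) (proj₁ v)) D)

IsKTupleDominating : (n r k : ℕ) → List (KVertex n r) → Set
IsKTupleDominating n r k D = Unique D × ((v : KVertex n r) → closedNbhdCount D v ≥ k)

{-# OPTIONS --safe #-}
-- Say that a vertex d straddles a set X of points if d contains some but not all of X. If m members
-- of a k-tuple dominating set D straddle a common X with |X| ≤ r, then an r-set v ⊇ X is neither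
-- equal to nor disjoint from any of them, so the at least k members of D in N[v] are other members
-- and |D| ≥ k + m.
-- For m = r, one point chosen cyclically from each of r members suffices. For the second bound,
-- r·|D| ≥ r(k + r) > n forces two members A, B of D to share a point x; together with one partner
-- point for each of r − 1 further members (chosen to escape A and B), x gives an X of size r that
-- is straddled by r + 1 members of D.
module Submission where

open import Defs
open import Data.Nat using (ℕ; _≤_; _<_; _+_; _*_; _∸_)
open import Data.Nat.Combinatorics using (_C_)
open import Data.List using (List; length)
open import Data.Product using (_×_)

open import Data.Nat using (zero; suc; z≤n; s≤s; _⊓_; _≤?_)
open import Data.Nat.Properties hiding (_≟_)
open import Data.Bool using (true; false)
open import Data.Fin using (Fin; zero; suc)
open import Data.Fin.Properties using (any?)
open import Data.Fin.Subset
  using (Subset; _∈_; _∉_; _⊆_; _∪_; _-_; _∩_; ∁; ⊥; ⁅_⁆; ⋃; ∣_∣; Nonempty; Empty)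
open import Data.Fin.Subset.Properties
  using (_∈?_; ∉⊥; x∈p∪q⁺; x∈p∪q⁻; x∈p∩q⁺; x∈p∩q⁻; x∈⁅x⁆; ∣⁅x⁆∣≡1; ∣⊥∣≡0; ∣p∣≤n; ∣∁p∣≡n∸∣p∣;
         x∈∁p⇒x∉p; nonempty?; drop-∷-Empty; s⊆s; out⊆; ⊆-antisym; p⊂q⇒∣p∣<∣q∣; x∈p∧x≢y⇒x∈p-y; x∈p⇒∣p-x∣<∣p∣)
open import Data.Vec using ([]; _∷_; here; there)
open import Data.List using ([]; _∷_; map; filter; take)
open import Data.Product using (Σ; ∃; _,_; proj₁; proj₂; map₂) renaming (map to map×)
open import Data.Sum using (_⊎_; inj₁; inj₂; [_,_]′)
open import Data.Empty using (⊥-elim)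
open import Function using (_∘_)
open import Data.List.Relation.Unary.Any using (Any; here; there)
open import Data.List.Relation.Unary.All using (All; []; _∷_)
import Data.List.Relation.Unary.All as All
open import Data.List.Membership.Propositional using (_─_; find) renaming (_∈_ to _∈ₗ_)
open import Data.List.Membership.Propositional.Properties using (∈-map⁺; ∈-filter⁻)
open import Data.List.Relation.Binary.Subset.Propositional using () renaming (_⊆_ to _⊆ₗ_)
open import Data.List.Relation.Unary.Unique.Propositional using (Unique; []; _∷_)
import Data.List.Relation.Unary.Unique.Propositional.Properties as Unique
import Data.List.Relation.Unary.All.Properties as All
import Data.List.Relation.Unary.Any.Properties as Any
open import Data.List.Relation.Binary.Subset.Propositional.Properties using (Any-resp-⊆)
open import Data.List.Properties using (length-map; length-filter; length-removeAt′; filter-all; length-take)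
open import Level using (Level)
open import Relation.Unary using (Pred; Decidable)
open import Relation.Binary.Definitions using (DecidableEquality)
open import Relation.Nullary using (¬_; yes; no)
open import Relation.Nullary.Decidable using (_×-dec_; ¬?; decidable-stable)
open import Relation.Binary.PropositionalEquality

private
  variable
    a ℓ : Level
    X : Set a
    k m n r : ℕ

∣p∪q∣≤∣p∣+∣q∣ : (p q : Subset n) → ∣ p ∪ q ∣ ≤ ∣ p ∣ + ∣ q ∣
∣p∪q∣≤∣p∣+∣q∣ []          []          = z≤n
∣p∪q∣≤∣p∣+∣q∣ (true ∷ p)  (true ∷ q)  = s≤s (≤-trans (∣p∪q∣≤∣p∣+∣q∣ p q) (+-monoʳ-≤ ∣ p ∣ (n≤1+n ∣ q ∣)))
∣p∪q∣≤∣p∣+∣q∣ (true ∷ p)  (false ∷ q) = s≤s (∣p∪q∣≤∣p∣+∣q∣ p q)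
∣p∪q∣≤∣p∣+∣q∣ (false ∷ p) (true ∷ q)  = ≤-trans (s≤s (∣p∪q∣≤∣p∣+∣q∣ p q)) (≤-reflexive (sym (+-suc ∣ p ∣ ∣ q ∣)))
∣p∪q∣≤∣p∣+∣q∣ (false ∷ p) (false ∷ q) = ∣p∪q∣≤∣p∣+∣q∣ p q

∣p∪q∣<∣p∣+∣q∣ : ∀ {x : Fin n} (p q : Subset n) → x ∈ p → x ∈ q → ∣ p ∪ q ∣ < ∣ p ∣ + ∣ q ∣
∣p∪q∣<∣p∣+∣q∣ (true ∷ p)  (true ∷ q)  here       here       =
  s≤s (≤-trans (s≤s (∣p∪q∣≤∣p∣+∣q∣ p q)) (≤-reflexive (sym (+-suc ∣ p ∣ ∣ q ∣))))
∣p∪q∣<∣p∣+∣q∣ (true ∷ p)  (true ∷ q)  (there x∈p) (there x∈q) =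
  s≤s (≤-trans (∣p∪q∣<∣p∣+∣q∣ p q x∈p x∈q) (+-monoʳ-≤ ∣ p ∣ (n≤1+n ∣ q ∣)))
∣p∪q∣<∣p∣+∣q∣ (true ∷ p)  (false ∷ q) (there x∈p) (there x∈q) = s≤s (∣p∪q∣<∣p∣+∣q∣ p q x∈p x∈q)
∣p∪q∣<∣p∣+∣q∣ (false ∷ p) (true ∷ q)  (there x∈p) (there x∈q) =
  ≤-trans (s≤s (∣p∪q∣<∣p∣+∣q∣ p q x∈p x∈q)) (≤-reflexive (sym (+-suc ∣ p ∣ ∣ q ∣)))
∣p∪q∣<∣p∣+∣q∣ (false ∷ p) (false ∷ q) (there x∈p) (there x∈q) = ∣p∪q∣<∣p∣+∣q∣ p q x∈p x∈q

∣p∣+∣q∣≤∣p∪q∣ : (p q : Subset n) → Empty (p ∩ q) → ∣ p ∣ + ∣ q ∣ ≤ ∣ p ∪ q ∣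
∣p∣+∣q∣≤∣p∪q∣ []          []          _ = z≤n
∣p∣+∣q∣≤∣p∪q∣ (true ∷ p)  (true ∷ q)  p∩q-empty = ⊥-elim (p∩q-empty (zero , here))
∣p∣+∣q∣≤∣p∪q∣ (true ∷ p)  (false ∷ q) p∩q-empty = s≤s (∣p∣+∣q∣≤∣p∪q∣ p q (drop-∷-Empty p∩q-empty))
∣p∣+∣q∣≤∣p∪q∣ (false ∷ p) (true ∷ q)  p∩q-empty =
  ≤-trans (≤-reflexive (+-suc ∣ p ∣ ∣ q ∣)) (s≤s (∣p∣+∣q∣≤∣p∪q∣ p q (drop-∷-Empty p∩q-empty)))
∣p∣+∣q∣≤∣p∪q∣ (false ∷ p) (false ∷ q) p∩q-empty = ∣p∣+∣q∣≤∣p∪q∣ p q (drop-∷-Empty p∩q-empty)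

0<∣p∣⇒Nonempty : (p : Subset n) → 0 < ∣ p ∣ → Nonempty p
0<∣p∣⇒Nonempty (true ∷ p)  _     = zero , here
0<∣p∣⇒Nonempty (false ∷ p) 0<∣p∣ with x , x∈p ← 0<∣p∣⇒Nonempty p 0<∣p∣ = suc x , there x∈p

∣p∣<n⇒∃∉ : (p : Subset n) → ∣ p ∣ < n → ∃ λ x → x ∉ p
∣p∣<n⇒∃∉ p ∣p∣<n = map₂ x∈∁p⇒x∉p (0<∣p∣⇒Nonempty (∁ p) 0<∣∁p∣)
  where
  0<∣∁p∣ : 0 < ∣ ∁ p ∣
  0<∣∁p∣ = subst (0 <_) (sym (∣∁p∣≡n∸∣p∣ p)) (m<n⇒0<n∸m ∣p∣<n)

⊆⊎∃∈∉ : (p q : Subset n) → p ⊆ q ⊎ ∃ λ x → x ∈ p × x ∉ q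
⊆⊎∃∈∉ p q with any? (λ x → (x ∈? p) ×-dec ¬? (x ∈? q))
... | yes x∈p∖q = inj₂ x∈p∖q
... | no  p∖q-empty = inj₁ λ {x} x∈p → decidable-stable (x ∈? q) (λ x∉q → p∖q-empty (x , x∈p , x∉q))

⊆∧∣q∣≤∣p∣⇒≡ : {p q : Subset n} → p ⊆ q → ∣ q ∣ ≤ ∣ p ∣ → p ≡ q
⊆∧∣q∣≤∣p∣⇒≡ {p = p} {q} p⊆q ∣q∣≤∣p∣ with ⊆⊎∃∈∉ q p
... | inj₁ q⊆p = ⊆-antisym p⊆q q⊆p
... | inj₂ (x , x∈q , x∉p) = ⊥-elim (<⇒≱ (p⊂q⇒∣p∣<∣q∣ (p⊆q , x , x∈q , x∉p)) ∣q∣≤∣p∣)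

≢⇒∃∈∉ : {p q : Subset n} → ∣ p ∣ ≡ ∣ q ∣ → p ≢ q → ∃ λ x → x ∈ p × x ∉ q
≢⇒∃∈∉ {p = p} {q} ∣p∣≡∣q∣ p≢q with ⊆⊎∃∈∉ p q
... | inj₁ p⊆q = ⊥-elim (p≢q (⊆∧∣q∣≤∣p∣⇒≡ p⊆q (≤-reflexive (sym ∣p∣≡∣q∣))))
... | inj₂ x∈p∖q = x∈p∖q

superset-of-size : (p : Subset n) → ∣ p ∣ ≤ m → m ≤ n → ∃ λ q → p ⊆ q × ∣ q ∣ ≡ m
superset-of-size {m = zero}  []          _           _           = [] , (λ ()) , refl
superset-of-size {m = suc m} (true ∷ p)  (s≤s ∣p∣≤m) (s≤s m≤n)
  with q , p⊆q , ∣q∣≡m ← superset-of-size p ∣p∣≤m m≤n = true ∷ q , s⊆s p⊆q , cong suc ∣q∣≡m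
superset-of-size {n = suc n} {m = m} (false ∷ p) ∣p∣≤m m≤1+n with m ≤? n
... | yes m≤n with q , p⊆q , ∣q∣≡m ← superset-of-size p ∣p∣≤m m≤n = false ∷ q , out⊆ p⊆q , ∣q∣≡m
superset-of-size {n = suc n} {m = zero}  (false ∷ p) _ _ | no m≰n = ⊥-elim (m≰n z≤n)
superset-of-size {n = suc n} {m = suc m} (false ∷ p) _ (s≤s m≤n) | no m≰n
  with q , p⊆q , ∣q∣≡m ← superset-of-size p (≤-trans (∣p∣≤n p) (≤-pred (≰⇒> m≰n))) m≤n
  = true ∷ q , out⊆ p⊆q , cong suc ∣q∣≡m

x∈⋃⁻ : ∀ {x : Fin n} (ps : List (Subset n)) → x ∈ ⋃ ps → Any (x ∈_) ps
x∈⋃⁻ []       x∈⊥    = ⊥-elim (∉⊥ x∈⊥)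
x∈⋃⁻ (p ∷ ps) x∈p∪⋃ = [ here , there ∘ x∈⋃⁻ ps ]′ (x∈p∪q⁻ p (⋃ ps) x∈p∪⋃)

x∈ₗxs⇒x∈⋃⁅xs⁆ : ∀ {x : Fin n} {xs} → x ∈ₗ xs → x ∈ ⋃ (map ⁅_⁆ xs)
x∈ₗxs⇒x∈⋃⁅xs⁆ {x = x} (here refl) = x∈p∪q⁺ (inj₁ (x∈⁅x⁆ x))
x∈ₗxs⇒x∈⋃⁅xs⁆ (there x∈xs)        = x∈p∪q⁺ (inj₂ (x∈ₗxs⇒x∈⋃⁅xs⁆ x∈xs))

∣⋃⁅xs⁆∣≤length : (xs : List (Fin n)) → ∣ ⋃ (map ⁅_⁆ xs) ∣ ≤ length xs
∣⋃⁅xs⁆∣≤length {n} []       = ≤-reflexive (∣⊥∣≡0 n)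
∣⋃⁅xs⁆∣≤length     (x ∷ xs) = begin
  ∣ ⁅ x ⁆ ∪ ⋃ (map ⁅_⁆ xs) ∣        ≤⟨ ∣p∪q∣≤∣p∣+∣q∣ ⁅ x ⁆ (⋃ (map ⁅_⁆ xs)) ⟩
  ∣ ⁅ x ⁆ ∣ + ∣ ⋃ (map ⁅_⁆ xs) ∣    ≡⟨ cong (_+ ∣ ⋃ (map ⁅_⁆ xs) ∣) (∣⁅x⁆∣≡1 x) ⟩
  suc ∣ ⋃ (map ⁅_⁆ xs) ∣            ≤⟨ s≤s (∣⋃⁅xs⁆∣≤length xs) ⟩
  suc (length xs)                   ∎
  where open ≤-Reasoning

∈-─⁺ : ∀ {x y} {xs : List X} (x∈xs : x ∈ₗ xs) → y ∈ₗ xs → x ≢ y → y ∈ₗ xs ─ x∈xs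
∈-─⁺ (here refl) (here refl)  x≢y = ⊥-elim (x≢y refl)
∈-─⁺ (here refl) (there y∈xs) _   = y∈xs
∈-─⁺ (there _)   (here refl)  _   = here refl
∈-─⁺ (there x∈xs) (there y∈xs) x≢y = there (∈-─⁺ x∈xs y∈xs x≢y)

module _ {P : Pred X ℓ} (P? : Decidable P) where

  length-filter-─ : ∀ {x} {xs : List X} (x∈xs : x ∈ₗ xs) → ¬ P x →
                    length (filter P? xs) ≤ length (filter P? (xs ─ x∈xs))
  length-filter-─ {xs = y ∷ ys} (here refl) ¬Px with P? y
  ... | yes Py = ⊥-elim (¬Px Py)
  ... | no  _  = ≤-refl
  length-filter-─ {xs = y ∷ ys} (there x∈ys) ¬Px with P? y
  ... | yes _ = s≤s (length-filter-─ x∈ys ¬Px)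
  ... | no  _ = length-filter-─ x∈ys ¬Px

  length-filter+length≤length : ∀ {xs ys : List X} → Unique ys → ys ⊆ₗ xs → All (¬_ ∘ P) ys →
                                length (filter P? xs) + length ys ≤ length xs
  length-filter+length≤length {xs} {[]}     _             _     _ =
    ≤-trans (≤-reflexive (+-identityʳ _)) (length-filter P? xs)
  length-filter+length≤length {xs} {y ∷ ys} (y∉ys ∷ uniq) ys⊆xs (¬Py ∷ ¬Pys) = begin
    length (filter P? xs) + suc (length ys)       ≡⟨ +-suc _ (length ys) ⟩
    suc (length (filter P? xs) + length ys)       ≤⟨ s≤s (+-monoˡ-≤ (length ys) (length-filter-─ y∈xs ¬Py)) ⟩
    suc (length (filter P? xs′) + length ys)      ≤⟨ s≤s (length-filter+length≤length uniq ys⊆xs′ ¬Pys) ⟩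
    suc (length xs′)                              ≡⟨ length-removeAt′ xs _ ⟨
    length xs                                     ∎
    where
    open ≤-Reasoning
    y∈xs = ys⊆xs (here refl)
    xs′ = xs ─ y∈xs
    ys⊆xs′ : ys ⊆ₗ xs′
    ys⊆xs′ z∈ys = ∈-─⁺ y∈xs (ys⊆xs (there z∈ys)) (All.lookup y∉ys z∈ys)

module _ (_≟_ : DecidableEquality X) where

  length≤1+length-filter-≢ : ∀ x {xs : List X} → Unique xs →
                             length xs ≤ suc (length (filter (λ y → ¬? (y ≟ x)) xs))
  length≤1+length-filter-≢ x {[]}     _             = z≤n
  length≤1+length-filter-≢ x {y ∷ ys} (y∉ys ∷ uniq) with y ≟ x
  ... | yes refl = s≤s (≤-reflexive (cong length (sym (filter-all (λ z → ¬? (z ≟ x)) x∉ys))))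
    where x∉ys = All.map (λ x≢z z≡x → x≢z (sym z≡x)) y∉ys
  ... | no  _    = s≤s (length≤1+length-filter-≢ x uniq)

KVertex-≡ : {u v : KVertex n r} → proj₁ u ≡ proj₁ v → u ≡ v
KVertex-≡ {u = p , ∣p∣≡r} {.p , ∣p∣≡r′} refl = cong (p ,_) (≡-irrelevant ∣p∣≡r ∣p∣≡r′)

_≟ᵥ_ : DecidableEquality (KVertex n r)
u ≟ᵥ v with proj₁ u ≟ proj₁ v
... | yes u≡v = yes (KVertex-≡ u≡v)
... | no  u≢v = no (u≢v ∘ cong proj₁)

KVertex-≢⇒∃∈∉ : {u v : KVertex n r} → u ≢ v → ∃ λ x → x ∈ proj₁ u × x ∉ proj₁ v
KVertex-≢⇒∃∈∉ {u = u} {v} u≢v = ≢⇒∃∈∉ (trans (proj₂ u) (sym (proj₂ v))) (u≢v ∘ KVertex-≡)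

∃KVertex⊇ : (xs : List (Fin n)) → length xs ≤ r → r ≤ n → Σ (KVertex n r) λ v → All (_∈ proj₁ v) xs
∃KVertex⊇ xs ∣xs∣≤r r≤n
  with v , ⋃⁅xs⁆⊆v , ∣v∣≡r ← superset-of-size (⋃ (map ⁅_⁆ xs)) (≤-trans (∣⋃⁅xs⁆∣≤length xs) ∣xs∣≤r) r≤n
  = (v , ∣v∣≡r) , All.tabulate (⋃⁅xs⁆⊆v ∘ x∈ₗxs⇒x∈⋃⁅xs⁆)

Meets : List (Fin n) → Subset n → Set
Meets xs p = Any (_∈ p) xs

Escapes : List (Fin n) → Subset n → Set
Escapes xs p = Any (_∉ p) xs

Straddles : List (Fin n) → Subset n → Set
Straddles xs p = Meets xs p × Escapes xs p

straddles-⊆ : ∀ {xs ys} {p : Subset n} → xs ⊆ₗ ys → Straddles xs p → Straddles ys p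
straddles-⊆ xs⊆ys = map× (Any-resp-⊆ xs⊆ys) (Any-resp-⊆ xs⊆ys)

straddles⇒∉N : ∀ {xs} {p q : Subset n} → All (_∈ q) xs → Straddles xs p → ¬ InClosedNbhd p q
straddles⇒∉N xs⊆q (_ , some∉p) (inj₁ refl) = let x∈p , x∉p = All.lookupAny xs⊆q some∉p in x∉p x∈p
straddles⇒∉N xs⊆q (some∈p , _) (inj₂ p∩q≡⊥) =
  let x∈q , x∈p = All.lookupAny xs⊆q some∈p in ∉⊥ (subst (_ ∈_) p∩q≡⊥ (x∈p∩q⁺ (x∈p , x∈q)))

record StraddledSubfamily (D : List (KVertex n r)) (m : ℕ) : Set where
  field
    members    : List (KVertex n r)
    unique     : Unique members
    ⊆D         : members ⊆ₗ D
    size       : length members ≡ m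
    points     : List (Fin n)
    few-points : length points ≤ r
    straddled  : All (Straddles points ∘ proj₁) members

dominating-size-bound : ∀ {D : List (KVertex n r)} → r ≤ n → IsKTupleDominating n r k D →
                        StraddledSubfamily D m → k + m ≤ length D
dominating-size-bound {n} {r} {k} {m} {D} r≤n (_ , dominating) F = begin
  k + m                                         ≡⟨ cong (k +_) size ⟨
  k + length members                            ≤⟨ +-monoˡ-≤ (length members) (dominating v) ⟩
  closedNbhdCount D v + length members          ≤⟨ length-filter+length≤length InN? unique ⊆D members∉N ⟩
  length D                                      ∎
  where
  open ≤-Reasoning
  open StraddledSubfamily F
  superset = ∃KVertex⊇ points few-points r≤n
  v = proj₁ superset
  InN? = λ (d : KVertex n r) → inClosedNbhd? (proj₁ d) (proj₁ v)
  members∉N : All (λ d → ¬ InClosedNbhd (proj₁ d) (proj₁ v)) members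
  members∉N = All.map (straddles⇒∉N (proj₂ superset)) straddled

path-points : (c : KVertex n r) (es : List (KVertex n r)) (f : KVertex n r) →
              Unique (c ∷ es) → All (f ≢_) (c ∷ es) →
              Σ (List (Fin n)) λ xs → length xs ≡ length (c ∷ es)
                × All (Meets xs ∘ proj₁) (c ∷ es) × All (Escapes xs ∘ proj₁) es × Escapes xs (proj₁ f)
path-points c [] f _ (f≢c ∷ [])
  with x , x∈c , x∉f ← KVertex-≢⇒∃∈∉ (f≢c ∘ sym)
  = x ∷ [] , refl , here x∈c ∷ [] , [] , here x∉f
path-points c (e ∷ es) f ((c≢e ∷ _) ∷ unique) (_ ∷ f≢e∷es)
  with x , x∈c , x∉e ← KVertex-≢⇒∃∈∉ c≢e
     | xs , ∣xs∣≡ , meets , escapes , f-escapes ← path-points e es f unique f≢e∷es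
  = x ∷ xs , cong suc ∣xs∣≡ , here x∈c ∷ All.map there meets
  , here x∉e ∷ All.map there escapes , there f-escapes

-- Choose xᵢ ∈ eᵢ ∖ eᵢ₊₁ cyclically: then eᵢ contains xᵢ and misses xᵢ₋₁.
cyclic-points : (S : List (KVertex n r)) → Unique S → 2 ≤ length S →
                Σ (List (Fin n)) λ xs → length xs ≡ length S × All (Straddles xs ∘ proj₁) S
cyclic-points (e ∷ e′ ∷ es) ((e≢e′ ∷ e≢es) ∷ unique) _
  with x , x∈e , x∉e′ ← KVertex-≢⇒∃∈∉ e≢e′
     | xs , ∣xs∣≡ , e′-meets ∷ es-meet , es-escape , e-escapes ← path-points e′ es e unique (e≢e′ ∷ e≢es)
  = x ∷ xs , cong suc ∣xs∣≡
  , (here x∈e , there e-escapes) ∷ (there e′-meets , here x∉e′)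
  ∷ All.map (map× there there) (All.zip (es-meet , es-escape))
cyclic-points (_ ∷ []) _ (s≤s ())

k+m⊓n≤n⇒k+m≤n : 0 < k → k + (m ⊓ n) ≤ n → k + m ≤ n
k+m⊓n≤n⇒k+m≤n {k} {m} {n} 0<k k+m⊓n≤n with ≤-total m n
... | inj₁ m≤n = subst (λ l → k + l ≤ n) (m≤n⇒m⊓n≡m m≤n) k+m⊓n≤n
... | inj₂ n≤m =
  ⊥-elim (n≮n n (≤-trans (+-monoˡ-≤ n 0<k) (subst (λ l → k + l ≤ n) (m≥n⇒m⊓n≡n n≤m) k+m⊓n≤n)))

k≤length : ∀ {D} → r ≤ n → IsKTupleDominating n r k D → k ≤ length D
k≤length {D = D} r≤n (_ , dominating) = ≤-trans (dominating (proj₁ (∃KVertex⊇ [] z≤n r≤n))) (length-filter _ D)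

cyclic-straddled-subfamily : ∀ {D : List (KVertex n r)} → 2 ≤ r → Unique D → 2 ≤ length D →
                              StraddledSubfamily D (r ⊓ length D)
cyclic-straddled-subfamily {r = r} {D} 2≤r unique 2≤∣D∣ = record
  { members    = take r D
  ; unique     = Unique.take⁺ r unique
  ; ⊆D         = All.lookup (All.take⁺ r (All.tabulate (λ d∈D → d∈D)))
  ; size       = length-take r D
  ; points     = proj₁ points
  ; few-points = ≤-trans (≤-reflexive (trans (proj₁ (proj₂ points)) (length-take r D))) (m⊓n≤m r (length D))
  ; straddled  = proj₂ (proj₂ points)
  }
  where
  points = cyclic-points (take r D) (Unique.take⁺ r unique)
                         (subst (2 ≤_) (sym (length-take r D)) (⊓-glb 2≤r 2≤∣D∣))

k+r≤length : ∀ {D : List (KVertex n r)} → 2 ≤ r → r ≤ n → 2 ≤ k →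
             IsKTupleDominating n r k D → k + r ≤ length D
k+r≤length 2≤r r≤n 2≤k D-dom = k+m⊓n≤n⇒k+m≤n (≤-trans (s≤s z≤n) 2≤k)
  (dominating-size-bound r≤n D-dom
    (cyclic-straddled-subfamily 2≤r (proj₁ D-dom) (≤-trans 2≤k (k≤length r≤n D-dom))))

record IntersectingPair (D : List (KVertex n r)) : Set where
  field
    A B : KVertex n r
    A∈D : A ∈ₗ D
    B∈D : B ∈ₗ D
    A≢B : A ≢ B
    x   : Fin n
    x∈A : x ∈ proj₁ A
    x∈B : x ∈ proj₁ B

IntersectingPair-∷ : ∀ {d} {D : List (KVertex n r)} → IntersectingPair D → IntersectingPair (d ∷ D)
IntersectingPair-∷ P = record
  { A = A ; B = B ; A∈D = there A∈D ; B∈D = there B∈D ; A≢B = A≢B ; x = x ; x∈A = x∈A ; x∈B = x∈B }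
  where open IntersectingPair P

intersecting-pair-or-spread : (D : List (KVertex n r)) → Unique D →
                              IntersectingPair D ⊎ r * length D ≤ ∣ ⋃ (map proj₁ D) ∣
intersecting-pair-or-spread {n} {r} [] _ = inj₂ (≤-reflexive (trans (*-zeroʳ r) (sym (∣⊥∣≡0 n))))
intersecting-pair-or-spread {r = r} (d ∷ D) (d∉D ∷ unique) with nonempty? (proj₁ d ∩ ⋃ (map proj₁ D))
... | yes (x , x∈d∩⋃D) =
  let x∈d , x∈⋃D    = x∈p∩q⁻ (proj₁ d) (⋃ (map proj₁ D)) x∈d∩⋃D
      e , e∈D , x∈e = find (Any.map⁻ (x∈⋃⁻ (map proj₁ D) x∈⋃D))
  in inj₁ (record { A = d ; B = e ; A∈D = here refl ; B∈D = there e∈D ; A≢B = All.lookup d∉D e∈D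
                  ; x = x ; x∈A = x∈d ; x∈B = x∈e })
... | no d∩⋃D-empty with intersecting-pair-or-spread D unique
...   | inj₁ P = inj₁ (IntersectingPair-∷ P)
...   | inj₂ r*∣D∣≤∣⋃D∣ = inj₂ (begin
  r * suc (length D)                     ≡⟨ *-suc r (length D) ⟩
  r + r * length D                       ≤⟨ +-monoʳ-≤ r r*∣D∣≤∣⋃D∣ ⟩
  r + ∣ ⋃ (map proj₁ D) ∣                ≡⟨ cong (_+ ∣ ⋃ (map proj₁ D) ∣) (proj₂ d) ⟨
  ∣ proj₁ d ∣ + ∣ ⋃ (map proj₁ D) ∣      ≤⟨ ∣p∣+∣q∣≤∣p∪q∣ (proj₁ d) (⋃ (map proj₁ D)) d∩⋃D-empty ⟩
  ∣ ⋃ (map proj₁ (d ∷ D)) ∣              ∎)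
  where open ≤-Reasoning

intersecting-pair : ∀ {D : List (KVertex n r)} → Unique D → n < r * length D → IntersectingPair D
intersecting-pair {n} {D = D} unique n<r*∣D∣ with intersecting-pair-or-spread D unique
... | inj₁ P = P
... | inj₂ r*∣D∣≤∣⋃D∣ = ⊥-elim (<⇒≱ n<r*∣D∣ (≤-trans r*∣D∣≤∣⋃D∣ (∣p∣≤n (⋃ (map proj₁ D)))))

∃partner : 0 < r → r < n → (x : Fin n) (C : KVertex n r) → ∃ λ y → Straddles (x ∷ y ∷ []) (proj₁ C)
∃partner 0<r r<n x (c , ∣c∣≡r) with x ∈? c
... | yes x∈c = let y , y∉c = ∣p∣<n⇒∃∉ c (subst (_< _) (sym ∣c∣≡r) r<n) in y , here x∈c , there (here y∉c)
... | no  x∉c = let y , y∈c = 0<∣p∣⇒Nonempty c (subst (0 <_) (sym ∣c∣≡r) 0<r) in y , there (here y∈c) , here x∉c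

∃partner-avoiding : r + r < n → (x : Fin n) (C Z : KVertex n r) → C ≢ Z →
                    ∃ λ y → Straddles (x ∷ y ∷ []) (proj₁ C) × y ∉ proj₁ Z
∃partner-avoiding r+r<n x C Z C≢Z with x ∈? proj₁ C
... | yes x∈C =
  let y , y∉C∪Z = ∣p∣<n⇒∃∉ (proj₁ C ∪ proj₁ Z) ∣C∪Z∣<n
  in y , (here x∈C , there (here (y∉C∪Z ∘ x∈p∪q⁺ ∘ inj₁))) , y∉C∪Z ∘ x∈p∪q⁺ ∘ inj₂
  where
  ∣C∪Z∣<n = ≤-<-trans (≤-trans (∣p∪q∣≤∣p∣+∣q∣ (proj₁ C) (proj₁ Z)) (≤-reflexive (cong₂ _+_ (proj₂ C) (proj₂ Z))))
                      r+r<n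
... | no  x∉C = let y , y∈C , y∉Z = KVertex-≢⇒∃∈∉ C≢Z in y , (there (here y∈C) , here x∉C) , y∉Z

pair⊆ : ∀ {x y : X} {xs} → x ∈ₗ xs → y ∈ₗ xs → (x ∷ y ∷ []) ⊆ₗ xs
pair⊆ x∈xs _    (here refl)         = x∈xs
pair⊆ _    y∈xs (there (here refl)) = y∈xs

-- x serves A and B; y₁ ∉ A and y₂ ∉ B are chosen as the partners of C₁ and C₂.
pair-points : 0 < r → r + r < n → (A B : KVertex n r) (x : Fin n) → x ∈ proj₁ A → x ∈ proj₁ B →
              (C₁ C₂ : KVertex n r) → C₁ ≢ A → C₂ ≢ B → (Cs : List (KVertex n r)) →
              Σ (List (Fin n)) λ xs → length xs ≡ 3 + length Cs
                × All (Straddles xs ∘ proj₁) (A ∷ B ∷ C₁ ∷ C₂ ∷ Cs)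
pair-points {r = r} 0<r r+r<n A B x x∈A x∈B C₁ C₂ C₁≢A C₂≢B Cs
  with y₁ , C₁-straddles , y₁∉A ← ∃partner-avoiding r+r<n x C₁ A C₁≢A
     | y₂ , C₂-straddles , y₂∉B ← ∃partner-avoiding r+r<n x C₂ B C₂≢B
  = xs , cong (3 +_) (length-map partner Cs)
  , (here x∈A , there (here y₁∉A)) ∷ (here x∈B , there (there (here y₂∉B)))
  ∷ straddles-⊆ (pair⊆ (here refl) (there (here refl))) C₁-straddles
  ∷ straddles-⊆ (pair⊆ (here refl) (there (there (here refl)))) C₂-straddles
  ∷ All.tabulate λ {C} C∈Cs →
      straddles-⊆ (pair⊆ (here refl) (there (there (there (∈-map⁺ partner C∈Cs))))) (proj₂ (partner-of C))
  where
  r<n = <-≤-trans (m<m+n r 0<r) (<⇒≤ r+r<n)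
  partner-of = ∃partner 0<r r<n x
  partner = proj₁ ∘ partner-of
  xs = x ∷ y₁ ∷ y₂ ∷ map partner Cs

-- Here A ∪ B has at most 3 points; a candidate F avoiding x and lying inside A ∪ B must equal (A ∪ B) - x.
two-point-straddle : 5 ≤ n → (A B : KVertex n 2) (x : Fin n) → x ∈ proj₁ A → x ∈ proj₁ B →
                     (C₁ C₂ : KVertex n 2) → C₁ ≢ C₂ →
                     Σ (KVertex n 2) λ F → F ∈ₗ C₁ ∷ C₂ ∷ []
                       × ∃ λ y → All (Straddles (x ∷ y ∷ []) ∘ proj₁) (A ∷ B ∷ F ∷ [])
two-point-straddle {n} 5≤n A B x x∈A x∈B C₁ C₂ C₁≢C₂ = choose (usable C₁) (usable C₂)
  where
  W = proj₁ A ∪ proj₁ B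

  x∈W : x ∈ W
  x∈W = x∈p∪q⁺ (inj₁ x∈A)

  ∣W∣≤3 : ∣ W ∣ ≤ 3
  ∣W∣≤3 = ≤-pred (≤-trans (∣p∪q∣<∣p∣+∣q∣ (proj₁ A) (proj₁ B) x∈A x∈B)
                          (≤-reflexive (cong₂ _+_ (proj₂ A) (proj₂ B))))

  Good : KVertex n 2 → Set
  Good F = ∃ λ y → All (Straddles (x ∷ y ∷ []) ∘ proj₁) (A ∷ B ∷ F ∷ [])

  good : ∀ {F y} → y ∉ W → Straddles (x ∷ y ∷ []) (proj₁ F) → Good F
  good {y = y} y∉W F-straddles = y , (here x∈A , there (here (y∉W ∘ x∈p∪q⁺ ∘ inj₁)))
                                   ∷ (here x∈B , there (here (y∉W ∘ x∈p∪q⁺ ∘ inj₂))) ∷ F-straddles ∷ []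

  usable : (F : KVertex n 2) → Good F ⊎ (x ∉ proj₁ F × proj₁ F ⊆ W)
  usable F with x ∈? proj₁ F | ⊆⊎∃∈∉ (proj₁ F) W
  ... | yes x∈F | _ =
    let y , y∉F∪W = ∣p∣<n⇒∃∉ (proj₁ F ∪ W) ∣F∪W∣<n
    in inj₁ (good (y∉F∪W ∘ x∈p∪q⁺ ∘ inj₂) (here x∈F , there (here (y∉F∪W ∘ x∈p∪q⁺ ∘ inj₁))))
    where
    ∣F∪W∣<n : ∣ proj₁ F ∪ W ∣ < n
    ∣F∪W∣<n = <-≤-trans (<-≤-trans (∣p∪q∣<∣p∣+∣q∣ (proj₁ F) W x∈F x∈W)
                                   (≤-trans (≤-reflexive (cong (_+ ∣ W ∣) (proj₂ F))) (+-monoʳ-≤ 2 ∣W∣≤3))) 5≤n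
  ... | no x∉F | inj₁ F⊆W              = inj₂ (x∉F , F⊆W)
  ... | no x∉F | inj₂ (y , y∈F , y∉W) = inj₁ (good y∉W (there (here y∈F) , here x∉F))

  ≡W-x : (F : KVertex n 2) → x ∉ proj₁ F → proj₁ F ⊆ W → proj₁ F ≡ W - x
  ≡W-x F x∉F F⊆W = ⊆∧∣q∣≤∣p∣⇒≡ (λ y∈F → x∈p∧x≢y⇒x∈p-y (F⊆W y∈F) λ { refl → x∉F y∈F })
                              (≤-trans (≤-pred (<-≤-trans (x∈p⇒∣p-x∣<∣p∣ x∈W) ∣W∣≤3))
                                       (≤-reflexive (sym (proj₂ F))))

  choose : Good C₁ ⊎ (x ∉ proj₁ C₁ × proj₁ C₁ ⊆ W) → Good C₂ ⊎ (x ∉ proj₁ C₂ × proj₁ C₂ ⊆ W) →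
           Σ (KVertex n 2) λ F → F ∈ₗ C₁ ∷ C₂ ∷ [] × Good F
  choose (inj₁ C₁-good) _            = C₁ , here refl , C₁-good
  choose (inj₂ _)       (inj₁ C₂-good) = C₂ , there (here refl) , C₂-good
  choose (inj₂ (x∉C₁ , C₁⊆W)) (inj₂ (x∉C₂ , C₂⊆W)) =
    ⊥-elim (C₁≢C₂ (KVertex-≡ (trans (≡W-x C₁ x∉C₁ C₁⊆W) (sym (≡W-x C₂ x∉C₂ C₂⊆W)))))

straddled-extension : ∀ {D : List (KVertex n r)} (P : IntersectingPair D) →
  let open IntersectingPair P in
  (T : List (KVertex n r)) → Unique T → All (λ C → C ∈ₗ D × C ≢ A × C ≢ B) T → suc (length T) ≡ r →
  (xs : List (Fin n)) → length xs ≤ r → All (Straddles xs ∘ proj₁) (A ∷ B ∷ T) → StraddledSubfamily D (r + 1)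
straddled-extension {r = r} P T unique-T T-props 1+∣T∣≡r xs ∣xs∣≤r straddled = record
  { members    = A ∷ B ∷ T
  ; unique     = (A≢B ∷ All.map (λ C-props → proj₁ (proj₂ C-props) ∘ sym) T-props)
               ∷ All.map (λ C-props → proj₂ (proj₂ C-props) ∘ sym) T-props ∷ unique-T
  ; ⊆D         = All.lookup (A∈D ∷ B∈D ∷ All.map proj₁ T-props)
  ; size       = trans (cong suc 1+∣T∣≡r) (+-comm 1 r)
  ; points     = xs
  ; few-points = ∣xs∣≤r
  ; straddled  = straddled
  }
  where open IntersectingPair P

straddled-extension-within : ∀ {D : List (KVertex n r)} → 2 ≤ r → r + r < n → (P : IntersectingPair D) →
  let open IntersectingPair P in
  (Cs : List (KVertex n r)) → Unique Cs → All (λ C → C ∈ₗ D × C ≢ A × C ≢ B) Cs → r ≤ length Cs →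
  StraddledSubfamily D (r + 1)
straddled-extension-within {r = 2} _ 4<n P (C₁ ∷ C₂ ∷ _) ((C₁≢C₂ ∷ _) ∷ _) (C₁-props ∷ C₂-props ∷ _) _ =
  let F , F∈C₁C₂ , y , straddled = two-point-straddle 4<n A B x x∈A x∈B C₁ C₂ C₁≢C₂
      F-props = All.lookup (C₁-props ∷ C₂-props ∷ []) F∈C₁C₂
  in straddled-extension P (F ∷ []) ([] ∷ []) (F-props ∷ []) refl (x ∷ y ∷ []) ≤-refl straddled
  where open IntersectingPair P
straddled-extension-within {r = suc (suc (suc r′))} _ r+r<n P (C₁ ∷ C₂ ∷ Cs) unique
                         props@((_ , C₁≢A , _) ∷ (_ , _ , C₂≢B) ∷ _) (s≤s (s≤s r′<∣Cs∣)) =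
  let xs , ∣xs∣≡ , straddled = pair-points (s≤s z≤n) r+r<n A B x x∈A x∈B C₁ C₂ C₁≢A C₂≢B (take r′ Cs)
  in straddled-extension P (C₁ ∷ C₂ ∷ take r′ Cs)
       (Unique.take⁺ (2 + r′) unique) (All.take⁺ (2 + r′) props)
       (cong (3 +_) ∣take∣≡r′) xs (≤-reflexive (trans ∣xs∣≡ (cong (3 +_) ∣take∣≡r′))) straddled
  where
  open IntersectingPair P
  ∣take∣≡r′ : length (take r′ Cs) ≡ r′
  ∣take∣≡r′ = trans (length-take r′ Cs) (m≤n⇒m⊓n≡m (<⇒≤ r′<∣Cs∣))
straddled-extension-within {r = 1} (s≤s ()) _ _ _ _ _ _
straddled-extension-within {r = suc (suc _)} _ _ _ (_ ∷ []) _ _ (s≤s ())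

pair-straddled-subfamily : ∀ {D : List (KVertex n r)} → 2 ≤ r → r + r < n → Unique D → 2 + r ≤ length D →
                           IntersectingPair D → StraddledSubfamily D (r + 1)
pair-straddled-subfamily {r = r} {D} 2≤r r+r<n unique 2+r≤∣D∣ P =
  straddled-extension-within 2≤r r+r<n P others (Unique.filter⁺ ≢B? (Unique.filter⁺ ≢A? unique))
    (All.tabulate others-props) r≤∣others∣
  where
  open IntersectingPair P
  ≢A? = λ C → ¬? (C ≟ᵥ A)
  ≢B? = λ C → ¬? (C ≟ᵥ B)
  others = filter ≢B? (filter ≢A? D)
  others-props : ∀ {C} → C ∈ₗ others → C ∈ₗ D × C ≢ A × C ≢ B
  others-props C∈others = let C∈D−A , C≢B = ∈-filter⁻ ≢B? C∈others
                              C∈D , C≢A   = ∈-filter⁻ ≢A? C∈D−A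
                          in C∈D , C≢A , C≢B
  r≤∣others∣ : r ≤ length others
  r≤∣others∣ = ≤-pred (≤-pred (≤-trans 2+r≤∣D∣ (≤-trans (length≤1+length-filter-≢ _≟ᵥ_ A unique)
                 (s≤s (length≤1+length-filter-≢ _≟ᵥ_ B (Unique.filter⁺ ≢A? unique))))))

k+r+1≤length : ∀ {D : List (KVertex n r)} → 2 ≤ r → r + r < n → 2 ≤ k → n < r * (k + r) →
               IsKTupleDominating n r k D → k + r + 1 ≤ length D
k+r+1≤length {r = r} {k} {D} 2≤r r+r<n 2≤k n<r[k+r] D-dom = begin
  k + r + 1    ≡⟨ +-assoc k r 1 ⟩
  k + (r + 1)  ≤⟨ dominating-size-bound r≤n D-dom (pair-straddled-subfamily 2≤r r+r<n (proj₁ D-dom) 2+r≤∣D∣ P) ⟩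
  length D     ∎
  where
  open ≤-Reasoning
  r≤n = ≤-trans (m≤m+n r r) (<⇒≤ r+r<n)
  k+r≤∣D∣ = k+r≤length 2≤r r≤n 2≤k D-dom
  2+r≤∣D∣ = ≤-trans (+-monoˡ-≤ r 2≤k) k+r≤∣D∣
  P = intersecting-pair (proj₁ D-dom) (<-≤-trans n<r[k+r] (*-monoʳ-≤ r k+r≤∣D∣))

-- The hypothesis on k only ensures that k-tuple dominating sets exist; the bounds hold regardless.
corollary13 : (n r k : ℕ) → 2 ≤ r → 2 * r + 1 ≤ n → 2 ≤ k
    → k ≤ ((n ∸ r) C r) + 1
    → ((D : List (KVertex n r)) → IsKTupleDominating n r k D → k + r ≤ length D)
      × (n < r * (k + r)
         → (D : List (KVertex n r)) → IsKTupleDominating n r k D → k + r + 1 ≤ length D)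
corollary13 n r k 2≤r 2r+1≤n 2≤k _ =
  (λ _ → k+r≤length 2≤r (≤-trans (m≤m+n r r) (<⇒≤ r+r<n)) 2≤k) ,
  (λ n<r[k+r] _ → k+r+1≤length 2≤r r+r<n 2≤k n<r[k+r])
  where
  r+r<n : r + r < n
  r+r<n = subst (_≤ n) (cong (λ m → suc (r + m)) (+-identityʳ r)) (subst (_≤ n) (+-comm (2 * r) 1) 2r+1≤n)
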